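{- Let $S$ be a finite set of first-order clauses, and let $\mathrm{ren}(S)$ be the set of propositional clauses defined in the context (the encoding for \textbf{OCC1N}). Then for every interpretation $M$ of the propositional variables (identified with the predicate symbols of $S$), the renamed clause set $r_M(S)$ belongs to the class \textbf{OCC1N} if and only if $M$ is a model of $\mathrm{ren}(S)$.
   Context: A clause is a finite set of literals; a literal is an atom $P(t_1,\dots,t_n)$ or its negation. The dual $\overline{L}$ of a literal is defined by $\overline{P(\cdots)}=\neg P(\cdots)$ and $\overline{\neg P(\cdots)}=P(\cdots)$. For a clause $C$, $C^+$ denotes the set of positive literals of $C$ and $C^-$ the set of negative literals. $\mathrm{var}(E)$ is the set of variables occurring in a term, atom, literal or clause $E$, and $\mathrm{occ}(v,E)$ is the number of occurrences of the variable $v$ in $E$. A renaming is a set $r$ of predicate symbols. For a literal $L$, $r(L)=\overline{L}$ if the predicate symbol of $L$ is in $r$, and $r(L)=L$ otherwise; $r(C)=\{r(L):L\in C\}$ and $r(S)=\{r(C):C\in S\}$. For an interpretation $M$ of propositional variables, $r_M$ is the set of propositional variables true in $M$ (a set of predicate symbols, hence a renaming). The propositional skeleton: $\mathrm{skel}(P(\cdots))=P$ and $\mathrm{skel}(\neg P(\cdots))=\neg P$, where $P$ is read as a propositional variable; for a set of literals, $\mathrm{skel}$ is applied elementwise. Depth of occurrence: for a variable $v$, $\tau_{\max}(v,v)=0$ and $\tau_{\max}(v,f(t_1,\dots,t_n))=1+\max\{\tau_{\max}(v,t_i): v\in\mathrm{var}(t_i)\}$; $\tau_{\min}$ is defined analogously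 with $\min$ in place of $\max$. For an atom or literal $\pm P(t_1,\dots,t_n)$ containing $v$, $\tau_{\max}(v,\pm P(t_1,\dots,t_n))=\max\{\tau_{\max}(v,t_i): v\in\mathrm{var}(t_i)\}$ and similarly $\tau_{\min}$ with $\min$; for a set of literals, $\tau_{\max}(v,\cdot)$ (resp. $\tau_{\min}$) is the maximum (resp. minimum) over those literals containing $v$. A clause set $S$ is in \textbf{OCC1N} iff every clause $C\in S$ satisfies: (a) $\mathrm{occ}(v,C^+)=1$ for all $v\in\mathrm{var}(C^+)$; and (b) $\tau_{\max}(v,C^+)\le\tau_{\min}(v,C^-)$ for all $v\in\mathrm{var}(C^-)\cap\mathrm{var}(C^+)$. For a clause $C$ define the sets of propositional clauses $\mathrm{ren}_1(C)=\{\{\mathrm{skel}(L)\}: L\in C,\ \exists v\,\mathrm{occ}(v,L)>1\}$, $\mathrm{ren}_2(C)=\{\{\mathrm{skel}(L),\mathrm{skel}(L')\}: L,L'\in C,\ L\ne L',\ \mathrm{var}(L)\cap\mathrm{var}(L')\neq\emptyset\}$, $\mathrm{ren}_3(C)=\{\{\mathrm{skel}(L),\overline{\mathrm{skel}(L')}\}: L,L'\in C,\ \exists v\,(v\in\mathrm{var}(L)\cap\mathrm{var}(L')\text{ and }\tau_{\max}(v,L)>\tau_{\min}(v,L'))\}$, and $\mathrm{ren}(S)=\bigcup_{C\in S}(\mathrm{ren}_1(C)\cup\mathrm{ren}_2(C)\cup\mathrm{ren}_3(C))$. -}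

module Defs where

open import Data.Nat using (ℕ; zero; suc; _+_; _≤_; _<_; _⊔_; _⊓_; _≡ᵇ_)
open import Data.Bool using (Bool; true; false; not; if_then_else_)
open import Data.List using (List; []; _∷_; map; filter)
open import Data.List.Membership.Propositional using (_∈_)
open import Data.List.Relation.Unary.Any using (Any)
open import Data.List.Relation.Unary.All using (All)
open import Data.Sum using (_⊎_)
open import Data.Maybe using (Maybe; just; nothing)
open import Data.Product using (_×_; _,_; ∃-syntax; Σ-syntax)
open import Relation.Binary.PropositionalEquality using (_≡_; _≢_)

data Term : Set where
  var : ℕ → Term
  fun : ℕ → List Term → Term

-- A literal: polarity (true = positive), predicate symbol, argument list.
record Literal : Set where
  constructor lit
  field
    pos  : Bool
    pred : ℕ
    args : List Term
open Literal public

-- A clause is a finite set of literals, represented by a list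
-- (the main theorem assumes these lists are duplicate-free).
Clause : Set
Clause = List Literal

ClauseSet : Set
ClauseSet = List Clause

mutual
  occT : ℕ → Term → ℕ
  occT v (var w) = if v ≡ᵇ w then 1 else 0
  occT v (fun f ts) = occTs v ts

  occTs : ℕ → List Term → ℕ
  occTs v [] = 0
  occTs v (t ∷ ts) = occT v t + occTs v ts

occL : ℕ → Literal → ℕ
occL v L = occTs v (args L)

occC : ℕ → Clause → ℕ
occC v [] = 0
occC v (L ∷ C) = occL v L + occC v C

inVarL : ℕ → Literal → Set
inVarL v L = 0 < occL v L

inVarC : ℕ → Clause → Set
inVarC v C = 0 < occC v C

posPart : Clause → Clause
posPart = filter (λ L → Data.Bool._≟_ (pos L) true)

negPart : Clause → Clause
negPart = filter (λ L → Data.Bool._≟_ (pos L) false)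

-- Depth of occurrence; nothing when v does not occur in the expression,
-- otherwise just the max / min over the sub-expressions containing v.
combine : (ℕ → ℕ → ℕ) → Maybe ℕ → Maybe ℕ → Maybe ℕ
combine op nothing  m        = m
combine op (just a) nothing  = just a
combine op (just a) (just b) = just (op a b)

sucM : Maybe ℕ → Maybe ℕ
sucM nothing  = nothing
sucM (just a) = just (suc a)

mutual
  τT : (ℕ → ℕ → ℕ) → ℕ → Term → Maybe ℕ
  τT op v (var w) = if v ≡ᵇ w then just 0 else nothing
  τT op v (fun f ts) = sucM (τTs op v ts)

  τTs : (ℕ → ℕ → ℕ) → ℕ → List Term → Maybe ℕ
  τTs op v [] = nothing
  τTs op v (t ∷ ts) = combine op (τT op v t) (τTs op v ts)

τL : (ℕ → ℕ → ℕ) → ℕ → Literal → Maybe ℕ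
τL op v L = τTs op v (args L)

τC : (ℕ → ℕ → ℕ) → ℕ → Clause → Maybe ℕ
τC op v [] = nothing
τC op v (L ∷ C) = combine op (τL op v L) (τC op v C)

τmaxL τminL : ℕ → Literal → Maybe ℕ
τmaxL = τL _⊔_
τminL = τL _⊓_

τmaxC τminC : ℕ → Clause → Maybe ℕ
τmaxC = τC _⊔_
τminC = τC _⊓_

OCC1NClause : Clause → Set
OCC1NClause C =
  (∀ v → inVarC v (posPart C) → occC v (posPart C) ≡ 1) ×
  (∀ v a b → τmaxC v (posPart C) ≡ just a → τminC v (negPart C) ≡ just b → a ≤ b)

OCC1N : ClauseSet → Set
OCC1N S = All OCC1NClause S

-- Renamings: a set of predicate symbols, given by its characteristic function.
Renaming : Set
Renaming = ℕ → Bool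

renameLit : Renaming → Literal → Literal
renameLit r L = if r (pred L) then lit (not (pos L)) (pred L) (args L) else L

renameClause : Renaming → Clause → Clause
renameClause r = map (renameLit r)

renameSet : Renaming → ClauseSet → ClauseSet
renameSet r = map (renameClause r)

-- Propositional literals (polarity, propositional variable) and clauses.
PLit : Set
PLit = Bool × ℕ

PClause : Set
PClause = List PLit

skel : Literal → PLit
skel L = (pos L , pred L)

dualP : PLit → PLit
dualP (b , p) = (not b , p)

Interp : Set
Interp = ℕ → Bool

-- r_M : the set of propositional variables true in M.
rOf : Interp → Renaming
rOf M = M

satLit : Interp → PLit → Set
satLit M (b , p) = M p ≡ b

satClause : Interp → PClause → Set
satClause M D = Any (satLit M) D

InRen1 : Clause → PClause → Set
InRen1 C D = Σ[ L ∈ Literal ] (L ∈ C × (∃[ v ] 1 < occL v L) × D ≡ skel L ∷ [])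

InRen2 : Clause → PClause → Set
InRen2 C D = Σ[ L ∈ Literal ] Σ[ L' ∈ Literal ]
  (L ∈ C × L' ∈ C × L ≢ L' × (∃[ v ] (inVarL v L × inVarL v L')) ×
   D ≡ skel L ∷ skel L' ∷ [])

InRen3 : Clause → PClause → Set
InRen3 C D = Σ[ L ∈ Literal ] Σ[ L' ∈ Literal ]
  (L ∈ C × L' ∈ C ×
   (∃[ v ] ∃[ a ] ∃[ b ] (τmaxL v L ≡ just a × τminL v L' ≡ just b × b < a)) ×
   D ≡ skel L ∷ dualP (skel L') ∷ [])

InRen : ClauseSet → PClause → Set
InRen S D = Σ[ C ∈ Clause ] (C ∈ S × (InRen1 C D ⊎ InRen2 C D ⊎ InRen3 C D))

ModelOfRen : Interp → ClauseSet → Set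
ModelOfRen M S = ∀ D → InRen S D → satClause M D

-- Under r_M a literal L of C becomes positive exactly when M falsifies skel L, and negative
-- exactly when M falsifies the dual of skel L. Hence M falsifies a clause of ren(C) exactly
-- when its literals land where they break OCC1N in r_M(C): for ren₁ and ren₂ a variable
-- occurring twice in r_M(C)⁺ (inside one literal or across two), for ren₃ a variable occurring
-- deeper in a positive literal than in a negative one. Conversely each violation of OCC1N is
-- witnessed by such literals: occ(v, C⁺) > 1 comes from one literal or from two distinct ones
-- (which is why C must be duplicate-free), and τmax over C⁺ and τmin over C⁻ are attained at
-- single literals because max and min are selective.
module Submission where

open import Defs
open import Data.List using (List)
open import Data.List.Relation.Unary.All using (All)
open import Data.List.Relation.Unary.Unique.Propositional using (Unique)
open import Function.Bundles using (_⇔_)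

open import Algebra.Definitions using (Selective)
open import Data.Bool using (Bool; true; false; _≟_)
open import Data.Bool.Properties using (not-¬; not-involutive)
open import Data.Empty using (⊥)
open import Data.List using ([]; _∷_; filter)
open import Data.List.Membership.Propositional using (_∈_)
open import Data.List.Membership.Propositional.Properties using (∈-map⁺; ∈-map⁻; ∈-filter⁺; ∈-filter⁻)
import Data.List.Relation.Unary.All as All
import Data.List.Relation.Unary.All.Properties as All
open import Data.List.Relation.Unary.AllPairs using (_∷_)
open import Data.List.Relation.Unary.Any using (here; there)
open import Data.List.Relation.Unary.Any.Properties using (singleton⁻)
import Data.List.Relation.Unary.Unique.Propositional.Properties as Unique
open import Data.Maybe using (just; nothing)
open import Data.Nat using (ℕ; zero; suc; _+_; _≤_; _≥_; _<_; _⊔_; _⊓_; z≤n; s≤s)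
open import Data.Nat.Properties hiding (_≟_)
open import Data.Product using (∃; _×_; _,_; uncurry)
open import Data.Sum using (_⊎_; inj₁; inj₂; [_,_])
open import Function.Base using (_∘_; flip)
open import Function.Bundles using (mk⇔; Equivalence)
open import Relation.Binary.PropositionalEquality using (_≡_; _≢_; refl; sym; trans; cong; cong₂; subst; module ≡-Reasoning)
open import Relation.Nullary using (¬_; contradiction)

args-renameLit : ∀ r L → args (renameLit r L) ≡ args L
args-renameLit r L with r (pred L)
... | true  = refl
... | false = refl

occL-renameLit : ∀ r v L → occL v (renameLit r L) ≡ occL v L
occL-renameLit r v L = cong (occTs v) (args-renameLit r L)

τL-renameLit : ∀ op r v L → τL op v (renameLit r L) ≡ τL op v L
τL-renameLit op r v L = cong (τTs op v) (args-renameLit r L)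

renameLit-involutive : ∀ r L → renameLit r (renameLit r L) ≡ L
renameLit-involutive r (lit b p as) with r p in rp
... | true  rewrite rp = cong (λ b′ → lit b′ p as) (not-involutive b)
... | false rewrite rp = refl

renameLit-injective : ∀ r {L L′} → renameLit r L ≡ renameLit r L′ → L ≡ L′
renameLit-injective r {L} {L′} eq = begin
  L                              ≡⟨ sym (renameLit-involutive r L) ⟩
  renameLit r (renameLit r L)    ≡⟨ cong (renameLit r) eq ⟩
  renameLit r (renameLit r L′)   ≡⟨ renameLit-involutive r L′ ⟩
  L′                             ∎
  where open ≡-Reasoning

renamed-negative⇔satisfied : ∀ M L → pos (renameLit M L) ≡ false ⇔ satLit M (skel L)
renamed-negative⇔satisfied M (lit b p as) with M p
renamed-negative⇔satisfied M (lit true  p as) | true  = mk⇔ (λ _ → refl) (λ _ → refl)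
renamed-negative⇔satisfied M (lit false p as) | true  = mk⇔ (λ ()) (λ ())
renamed-negative⇔satisfied M (lit true  p as) | false = mk⇔ (λ ()) (λ ())
renamed-negative⇔satisfied M (lit false p as) | false = mk⇔ (λ _ → refl) (λ _ → refl)

renamed-positive⇔dual-satisfied : ∀ M L → pos (renameLit M L) ≡ true ⇔ satLit M (dualP (skel L))
renamed-positive⇔dual-satisfied M (lit b p as) with M p
renamed-positive⇔dual-satisfied M (lit true  p as) | true  = mk⇔ (λ ()) (λ ())
renamed-positive⇔dual-satisfied M (lit false p as) | true  = mk⇔ (λ _ → refl) (λ _ → refl)
renamed-positive⇔dual-satisfied M (lit true  p as) | false = mk⇔ (λ _ → refl) (λ _ → refl)
renamed-positive⇔dual-satisfied M (lit false p as) | false = mk⇔ (λ ()) (λ ())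

-- posPart = polarPart true and negPart = polarPart false hold definitionally.
polarPart : Bool → Clause → Clause
polarPart b = filter (λ L → pos L ≟ b)

∈-polarPart-renamed⁺ : ∀ r b {L C} → L ∈ C → pos (renameLit r L) ≡ b →
  renameLit r L ∈ polarPart b (renameClause r C)
∈-polarPart-renamed⁺ r b L∈C = ∈-filter⁺ (λ L → pos L ≟ b) (∈-map⁺ (renameLit r) L∈C)

∈-polarPart-renamed⁻ : ∀ r b {x C} → x ∈ polarPart b (renameClause r C) →
  ∃ λ L → L ∈ C × x ≡ renameLit r L × pos x ≡ b
∈-polarPart-renamed⁻ r b x∈ with ∈-filter⁻ (λ L → pos L ≟ b) x∈
... | x∈rC , px with ∈-map⁻ (renameLit r) x∈rC
... | L , L∈C , x≡rL = L , L∈C , x≡rL , px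

occL≤occC : ∀ v {L C} → L ∈ C → occL v L ≤ occC v C
occL≤occC v {C = L ∷ C} (here refl) = m≤m+n (occL v L) (occC v C)
occL≤occC v {C = L ∷ C} (there x∈) = ≤-trans (occL≤occC v x∈) (m≤n+m (occC v C) (occL v L))

occL+occL≤occC : ∀ v {L L′ C} → L ∈ C → L′ ∈ C → L ≢ L′ → occL v L + occL v L′ ≤ occC v C
occL+occL≤occC v (here refl) (here refl) L≢L′ = contradiction refl L≢L′
occL+occL≤occC v {L} (here refl) (there L′∈) _ = +-monoʳ-≤ (occL v L) (occL≤occC v L′∈)
occL+occL≤occC v {L} {L′} {C = _ ∷ C} (there L∈) (here refl) _ = begin
  occL v L + occL v L′  ≡⟨ +-comm (occL v L) (occL v L′) ⟩
  occL v L′ + occL v L  ≤⟨ +-monoʳ-≤ (occL v L′) (occL≤occC v L∈) ⟩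
  occL v L′ + occC v C  ∎
  where open ≤-Reasoning
occL+occL≤occC v {C = K ∷ C} (there L∈) (there L′∈) L≢L′ =
  ≤-trans (occL+occL≤occC v L∈ L′∈ L≢L′) (m≤n+m (occC v C) (occL v K))

occC≡0 : ∀ v C → (∀ {L} → L ∈ C → occL v L ≡ 0) → occC v C ≡ 0
occC≡0 v []      _      = refl
occC≡0 v (L ∷ C) absent = cong₂ _+_ (absent (here refl)) (occC≡0 v C (absent ∘ there))

occC≤1 : ∀ v {C} → Unique C → (∀ {L} → L ∈ C → occL v L ≤ 1) →
  (∀ {L L′} → L ∈ C → L′ ∈ C → L ≢ L′ → inVarL v L → inVarL v L′ → ⊥) → occC v C ≤ 1
occC≤1 v {[]}    _            _      _      = z≤n
occC≤1 v {L ∷ C} (L∉C ∷ uniq) single shared with n≤1⇒n≡0∨n≡1 (single (here refl))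
... | inj₁ occ≡0 = begin
  occL v L + occC v C  ≡⟨ cong (_+ occC v C) occ≡0 ⟩
  occC v C             ≤⟨ occC≤1 v uniq (single ∘ there) (λ K∈ K′∈ → shared (there K∈) (there K′∈)) ⟩
  1                    ∎
  where open ≤-Reasoning
... | inj₂ occ≡1 = ≤-reflexive (cong₂ _+_ occ≡1 (occC≡0 v C absent))
  where
  absent : ∀ {K} → K ∈ C → occL v K ≡ 0
  absent K∈C = n≤0⇒n≡0 (≮⇒≥ (shared (here refl) (there K∈C) (All.lookup L∉C K∈C) (≤-reflexive (sym occ≡1))))

combine-selective : ∀ {op} → Selective _≡_ op → ∀ x y {a} → combine op x y ≡ just a →
  x ≡ just a ⊎ y ≡ just a
combine-selective sel nothing  y        eq   = inj₂ eq
combine-selective sel (just b) nothing  eq   = inj₁ eq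
combine-selective sel (just b) (just c) refl = [ inj₁ ∘ cong just ∘ sym , inj₂ ∘ cong just ∘ sym ] (sel b c)

τC-attained : ∀ {op} → Selective _≡_ op → ∀ v C {a} → τC op v C ≡ just a →
  ∃ λ L → L ∈ C × τL op v L ≡ just a
τC-attained {op} sel v (L ∷ C) τC≡a with combine-selective sel (τL op v L) (τC op v C) τC≡a
... | inj₁ τL≡a = L , here refl , τL≡a
... | inj₂ τC≡a′ = let K , K∈C , τK≡a = τC-attained sel v C τC≡a′ in K , there K∈C , τK≡a

module _ {op : ℕ → ℕ → ℕ} {_≼_ : ℕ → ℕ → Set}
         (≼-refl : ∀ {a} → a ≼ a) (≼-trans : ∀ {a b c} → a ≼ b → b ≼ c → a ≼ c)
         (≼-opˡ : ∀ a b → a ≼ op a b) (≼-opʳ : ∀ a b → b ≼ op a b) where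

  combine-boundˡ : ∀ a y → ∃ λ c → combine op (just a) y ≡ just c × a ≼ c
  combine-boundˡ a nothing  = a , refl , ≼-refl
  combine-boundˡ a (just b) = op a b , refl , ≼-opˡ a b

  combine-boundʳ : ∀ x b → ∃ λ c → combine op x (just b) ≡ just c × b ≼ c
  combine-boundʳ nothing  b = b , refl , ≼-refl
  combine-boundʳ (just a) b = op a b , refl , ≼-opʳ a b

  τL≼τC : ∀ v {L C a} → L ∈ C → τL op v L ≡ just a → ∃ λ c → τC op v C ≡ just c × a ≼ c
  τL≼τC v {C = L ∷ C} (here refl) τL≡a rewrite τL≡a = combine-boundˡ _ (τC op v C)
  τL≼τC v {C = K ∷ C} (there L∈C) τL≡a with τL≼τC v L∈C τL≡a
  ... | c , τC≡c , a≼c rewrite τC≡c =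
    let d , τKC≡d , c≼d = combine-boundʳ (τL op v K) c in d , τKC≡d , ≼-trans a≼c c≼d

τmaxL≤τmaxC : ∀ v {L C a} → L ∈ C → τmaxL v L ≡ just a → ∃ λ c → τmaxC v C ≡ just c × a ≤ c
τmaxL≤τmaxC = τL≼τC ≤-refl ≤-trans m≤m⊔n m≤n⊔m

τminC≤τminL : ∀ v {L C a} → L ∈ C → τminL v L ≡ just a → ∃ λ c → τminC v C ≡ just c × c ≤ a
τminC≤τminL = τL≼τC {_≼_ = _≥_} ≤-refl (flip ≤-trans) m⊓n≤m m⊓n≤n

Linear : Clause → Set
Linear C = ∀ v → occC v C ≤ 1

DepthOrdered : Clause → Set
DepthOrdered C = ∀ v a b → τmaxC v (posPart C) ≡ just a → τminC v (negPart C) ≡ just b → a ≤ b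

occ≡1⇔linear : ∀ C → (∀ v → inVarC v C → occC v C ≡ 1) ⇔ Linear C
occ≡1⇔linear C = mk⇔ to (λ lin v v∈C → ≤-antisym (lin v) v∈C)
  where
  to : (∀ v → inVarC v C → occC v C ≡ 1) → Linear C
  to occ≡1 v with occC v C | occ≡1 v
  ... | zero  | _      = z≤n
  ... | suc _ | occ≡1ᵥ = ≤-reflexive (occ≡1ᵥ (s≤s z≤n))

RenClause : Clause → PClause → Set
RenClause C D = InRen1 C D ⊎ InRen2 C D ⊎ InRen3 C D

_⊨_ : Interp → (PClause → Set) → Set
M ⊨ P = ∀ D → P D → satClause M D

satPair⁻ : ∀ {M l l′} → satClause M (l ∷ l′ ∷ []) → satLit M l ⊎ satLit M l′
satPair⁻ (here sat)         = inj₁ sat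
satPair⁻ (there (here sat)) = inj₂ sat

module _ (M : Interp) {C : Clause} where

  private
    r : Literal → Literal
    r = renameLit M

    C⁺ C⁻ : Clause
    C⁺ = posPart (renameClause M C)
    C⁻ = negPart (renameClause M C)

    positive⇒unsatisfied : ∀ {L} → pos (r L) ≡ true → ¬ satLit M (skel L)
    positive⇒unsatisfied {L} pol sat = not-¬ pol (Equivalence.from (renamed-negative⇔satisfied M L) sat)

    negative⇒dual-unsatisfied : ∀ {L} → pos (r L) ≡ false → ¬ satLit M (dualP (skel L))
    negative⇒dual-unsatisfied {L} pol sat = not-¬ pol (Equivalence.from (renamed-positive⇔dual-satisfied M L) sat)

  linear⇒⊨ren₁ : Linear C⁺ → M ⊨ InRen1 C
  linear⇒⊨ren₁ lin _ (L , L∈C , (v , 1<occ) , refl) with pos (r L) in pol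
  ... | false = here (Equivalence.to (renamed-negative⇔satisfied M L) pol)
  ... | true  = contradiction (begin-strict
    1             <⟨ 1<occ ⟩
    occL v L      ≡⟨ sym (occL-renameLit M v L) ⟩
    occL v (r L)  ≤⟨ occL≤occC v (∈-polarPart-renamed⁺ M true L∈C pol) ⟩
    occC v C⁺     ≤⟨ lin v ⟩
    1             ∎) (<-irrefl refl)
    where open ≤-Reasoning

  linear⇒⊨ren₂ : Linear C⁺ → M ⊨ InRen2 C
  linear⇒⊨ren₂ lin _ (L , L′ , L∈C , L′∈C , L≢L′ , (v , v∈L , v∈L′) , refl)
    with pos (r L) in pol | pos (r L′) in pol′
  ... | false | _     = here (Equivalence.to (renamed-negative⇔satisfied M L) pol)
  ... | true  | false = there (here (Equivalence.to (renamed-negative⇔satisfied M L′) pol′))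
  ... | true  | true  = contradiction (begin
    2                             ≤⟨ +-mono-≤ v∈L v∈L′ ⟩
    occL v L + occL v L′          ≡⟨ sym (cong₂ _+_ (occL-renameLit M v L) (occL-renameLit M v L′)) ⟩
    occL v (r L) + occL v (r L′)  ≤⟨ occL+occL≤occC v (∈-polarPart-renamed⁺ M true L∈C pol)
                                       (∈-polarPart-renamed⁺ M true L′∈C pol′) (L≢L′ ∘ renameLit-injective M) ⟩
    occC v C⁺                     ≤⟨ lin v ⟩
    1                             ∎) (<-irrefl refl)
    where open ≤-Reasoning

  depthOrdered⇒⊨ren₃ : DepthOrdered (renameClause M C) → M ⊨ InRen3 C
  depthOrdered⇒⊨ren₃ depth _ (L , L′ , L∈C , L′∈C , (v , a , b , τL≡a , τL′≡b , b<a) , refl)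
    with pos (r L) in pol | pos (r L′) in pol′
  ... | false | _     = here (Equivalence.to (renamed-negative⇔satisfied M L) pol)
  ... | true  | true  = there (here (Equivalence.to (renamed-positive⇔dual-satisfied M L′) pol′))
  ... | true  | false =
    let a′ , τC⁺≡a′ , a≤a′ = τmaxL≤τmaxC v (∈-polarPart-renamed⁺ M true L∈C pol)
                               (trans (τL-renameLit _⊔_ M v L) τL≡a)
        b′ , τC⁻≡b′ , b′≤b = τminC≤τminL v (∈-polarPart-renamed⁺ M false L′∈C pol′)
                               (trans (τL-renameLit _⊓_ M v L′) τL′≡b)
    in contradiction (≤-trans a≤a′ (≤-trans (depth v a′ b′ τC⁺≡a′ τC⁻≡b′) b′≤b)) (<⇒≱ b<a)

  ⊨ren₁₂⇒linear : Unique C → M ⊨ InRen1 C → M ⊨ InRen2 C → Linear C⁺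
  ⊨ren₁₂⇒linear uniq ⊨ren₁ ⊨ren₂ v = occC≤1 v uniq⁺ single unshared
    where
    uniq⁺ : Unique C⁺
    uniq⁺ = Unique.filter⁺ (λ L → pos L ≟ true) (Unique.map⁺ (renameLit-injective M) uniq)

    single : ∀ {x} → x ∈ C⁺ → occL v x ≤ 1
    single x∈ with ∈-polarPart-renamed⁻ M true x∈
    ... | L , L∈C , refl , pol = ≮⇒≥ λ 1<occ → positive⇒unsatisfied pol (singleton⁻
      (⊨ren₁ _ (L , L∈C , (v , subst (1 <_) (occL-renameLit M v L) 1<occ) , refl)))

    unshared : ∀ {x y} → x ∈ C⁺ → y ∈ C⁺ → x ≢ y → inVarL v x → inVarL v y → ⊥
    unshared x∈ y∈ x≢y v∈x v∈y with ∈-polarPart-renamed⁻ M true x∈ | ∈-polarPart-renamed⁻ M true y∈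
    ... | L , L∈C , refl , pol | L′ , L′∈C , refl , pol′ =
      [ positive⇒unsatisfied pol , positive⇒unsatisfied pol′ ] (satPair⁻ (⊨ren₂ _
        (L , L′ , L∈C , L′∈C , x≢y ∘ cong r ,
         (v , subst (0 <_) (occL-renameLit M v L) v∈x , subst (0 <_) (occL-renameLit M v L′) v∈y) , refl)))

  ⊨ren₃⇒depthOrdered : M ⊨ InRen3 C → DepthOrdered (renameClause M C)
  ⊨ren₃⇒depthOrdered ⊨ren₃ v a b τC⁺≡a τC⁻≡b
    with τC-attained ⊔-sel v C⁺ τC⁺≡a | τC-attained ⊓-sel v C⁻ τC⁻≡b
  ... | x , x∈ , τx≡a | y , y∈ , τy≡b
    with ∈-polarPart-renamed⁻ M true x∈ | ∈-polarPart-renamed⁻ M false y∈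
  ... | L , L∈C , refl , pol | L′ , L′∈C , refl , pol′ = ≮⇒≥ λ b<a →
    [ positive⇒unsatisfied pol , negative⇒dual-unsatisfied pol′ ] (satPair⁻ (⊨ren₃ _
      (L , L′ , L∈C , L′∈C ,
       (v , a , b , trans (sym (τL-renameLit _⊔_ M v L)) τx≡a , trans (sym (τL-renameLit _⊓_ M v L′)) τy≡b , b<a) ,
       refl)))

  occ1n⇒⊨ren : OCC1NClause (renameClause M C) → M ⊨ RenClause C
  occ1n⇒⊨ren (occ≡1 , depth) D = [ linear⇒⊨ren₁ lin D , [ linear⇒⊨ren₂ lin D , depthOrdered⇒⊨ren₃ depth D ] ]
    where
    lin : Linear C⁺
    lin = Equivalence.to (occ≡1⇔linear C⁺) occ≡1

  ⊨ren⇒occ1n : Unique C → M ⊨ RenClause C → OCC1NClause (renameClause M C)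
  ⊨ren⇒occ1n uniq ⊨ren =
    Equivalence.from (occ≡1⇔linear C⁺) (⊨ren₁₂⇒linear uniq (λ D → ⊨ren D ∘ inj₁) (λ D → ⊨ren D ∘ inj₂ ∘ inj₁)) ,
    ⊨ren₃⇒depthOrdered (λ D → ⊨ren D ∘ inj₂ ∘ inj₂)

modelOfRen⇔clausewise : ∀ M S → ModelOfRen M S ⇔ All (λ C → M ⊨ RenClause C) S
modelOfRen⇔clausewise M S = mk⇔
  (λ ⊨S → All.tabulate λ C∈S D ren → ⊨S D (_ , C∈S , ren))
  (λ ⊨Cs D → λ { (C , C∈S , ren) → All.lookup ⊨Cs C∈S D ren })

mainTheorem1 : (S : ClauseSet) → All Unique S → (M : Interp) →
    OCC1N (renameSet (rOf M) S) ⇔ ModelOfRen M S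
mainTheorem1 S uniq M = mk⇔
  (λ occ1n → Equivalence.from (modelOfRen⇔clausewise M S) (All.map (occ1n⇒⊨ren M) (All.map⁻ occ1n)))
  (λ ⊨S → All.map⁺ (All.zipWith (uncurry (⊨ren⇒occ1n M)) (uniq , Equivalence.to (modelOfRen⇔clausewise M S) ⊨S)))
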